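{- Consider the Nibble algorithm run on a graph $G=(V,E)$ with palette $\mathcal{C}$. Fix the random bits that determine which edges get selected in which rounds. Then, over the remaining randomness, for all nodes $u \in V$, all rounds $i \in [T]$, all subsets $C \subseteq \mathcal{C}$ and all permutations $\pi : \mathcal{C} \to \mathcal{C}$, \[ \Pr\left[ P_i(u) = C \right] = \Pr\left[ \pi(P_i(u)) = C \right]. \]
   Context: Fix a constant $\epsilon \in (0,1/10)$, a graph $G=(V,E)$ of maximum degree at most $\Delta$, and a palette $\mathcal{C}$ of $\lceil(1+\epsilon)\Delta\rceil$ colors. Let $T := \lfloor (1/\epsilon)\log(1/\epsilon)\rfloor$. For a node $v$, $N(v)$ denotes the set of edges incident on $v$; for an edge $e=(u,v)$, $N(e) := N(u)\cup N(v)$. The Nibble algorithm: set $E_1 := E$. For rounds $i=1,\dots,T$: each edge of $E_i$ independently joins the set $S_i$ of selected edges with probability $\epsilon$; for each node $u$ let $P_i(u) := \mathcal{C} \setminus \{\tilde\chi(f) : f \in N(u) \cap (S_1\cup\dots\cup S_{i-1})\}$ (the palette of $u$ at round $i$), and for $e=(u,v)$ let $P_i(e) := P_i(u)\cap P_i(v)$; each $e \in S_i$ independently chooses a tentative color $\tilde\chi(e)$ uniformly at random from $P_i(e)$, or $\tilde\chi(e) := \bot$ if $P_i(e)=\varnothing$; then $E_{i+1} := E_i \setminus S_i$.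
   Formalization: The constant $\epsilon$ ranges over the rationals in $(0,1/10)$. -}

module Defs where

open import Data.Nat as ℕ using (ℕ; zero; suc)
open import Data.Integer as ℤ using (ℤ; +_)
open import Data.Rational as ℚ using (ℚ; 0ℚ; 1ℚ; _/_; _*_; _+_; _≤_; _<_)
open import Data.Fin as Fin using (Fin; toℕ)
open import Data.Fin.Subset using (Subset; ∣_∣; _∩_)
open import Data.Fin.Permutation using (Permutation′; _⟨$⟩ˡ_)
open import Data.Bool using (Bool; true; false; _∧_; _∨_; not; if_then_else_)
open import Data.Maybe using (Maybe; just; nothing)
open import Data.Product using (_×_; _,_; proj₁; proj₂)
open import Data.List as List using (List; []; _∷_; allFin; foldr; map; concatMap; filter; length)
open import Data.Vec as Vec using (Vec; []; _∷_; lookup; tabulate)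
open import Data.Vec.Properties using (≡-dec)
import Data.Bool.Properties as BoolP
open import Relation.Nullary using (¬_; does)
open import Relation.Binary.PropositionalEquality using (_≡_; _≢_)

record Graph : Set where
  field
    n    : ℕ
    m    : ℕ
    ends : Fin m → Fin n × Fin n

open Graph public

incidentᵇ : (G : Graph) → Fin (m G) → Fin (n G) → Bool
incidentᵇ G f u = does (proj₁ (ends G f) Fin.≟ u) ∨ does (proj₂ (ends G f) Fin.≟ u)

degree : (G : Graph) → Fin (n G) → ℕ
degree G u = length (filter (λ f → incidentᵇ G f u Data.Bool.≟ true) (allFin (m G)))
  where import Data.Bool

Simple : Graph → Set
Simple G =
  (∀ e → proj₁ (ends G e) ≢ proj₂ (ends G e)) ×
  (∀ e f → proj₁ (ends G e) ≡ proj₁ (ends G f) → proj₂ (ends G e) ≡ proj₂ (ends G f) → e ≡ f) ×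
  (∀ e f → proj₁ (ends G e) ≡ proj₂ (ends G f) → proj₂ (ends G e) ≡ proj₁ (ends G f) → e ≡ f)

MaxDegreeAtMost : Graph → ℕ → Set
MaxDegreeAtMost G Δ = ∀ u → degree G u ℕ.≤ Δ

-- Parameters:  T = ⌊ (1/ε) ln (1/ε) ⌋.
-- For x ≥ 0:  e^x ≤ y  iff every partial sum  Σ_{j<N} x^j / j!  is ≤ y.

_^ℚ_ : ℚ → ℕ → ℚ
x ^ℚ zero  = 1ℚ
x ^ℚ suc j = x * (x ^ℚ j)

expTerm : ℚ → ℕ → ℚ
expTerm x zero    = 1ℚ
expTerm x (suc j) = expTerm x j * x * (+ 1 / suc j)

expPartial : ℚ → ℕ → ℚ
expPartial x zero    = 0ℚ
expPartial x (suc N) = expPartial x N + expTerm x N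

ExpLe : ℚ → ℚ → Set
ExpLe x y = ∀ N → expPartial x N ≤ y

-- IsNibbleT ε T  means  T = ⌊ (1/ε) ln (1/ε) ⌋  (for 0 < ε < 1 this number is ≥ 0).
-- t ≤ (1/ε) ln(1/ε)  iff  e^{t ε} ≤ 1/ε.
IsNibbleT : (ε : ℚ) → .{{_ : ℚ.NonZero ε}} → ℕ → Set
IsNibbleT ε T =
  ExpLe ((+ T / 1) * ε) (ℚ.1/ ε) × ¬ ExpLe ((+ suc T / 1) * ε) (ℚ.1/ ε)

-- Rounds are indexed by Fin T (index j stands for round j+1).
-- A selection schedule  sel : Fin m → Maybe (Fin T)  records, for each edge,
-- the round in which it was selected (nothing = never selected).
-- An outcome of the remaining randomness is the vector of tentative colours
-- χ : Vec (Maybe (Fin k)) m  (nothing = ⊥ or not selected).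

module Nibble (G : Graph) (k T : ℕ) (sel : Fin (m G) → Maybe (Fin T)) where

  Outcome : Set
  Outcome = Vec (Maybe (Fin k)) (m G)

  selectedBeforeᵇ : Fin (m G) → Fin T → Bool
  selectedBeforeᵇ f i with sel f
  ... | nothing = false
  ... | just r  = does (toℕ r ℕ.<? toℕ i)

  colourIsᵇ : Outcome → Fin (m G) → Fin k → Bool
  colourIsᵇ χ f c with lookup χ f
  ... | nothing = false
  ... | just d  = does (d Fin.≟ c)

  anyᵇ : ∀ {a} → (Fin a → Bool) → Bool
  anyᵇ p = foldr _∨_ false (map p (allFin _))

  P : Outcome → Fin T → Fin (n G) → Subset k
  P χ i u = tabulate λ c →
    not (anyᵇ λ f → incidentᵇ G f u ∧ selectedBeforeᵇ f i ∧ colourIsᵇ χ f c)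

  Pₑ : Outcome → Fin T → Fin (m G) → Subset k
  Pₑ χ i e = P χ i (proj₁ (ends G e)) ∩ P χ i (proj₂ (ends G e))

  -- conditional probability that edge e receives the value  lookup χ e,
  -- given the tentative colours of all edges selected in earlier rounds.
  factor : Outcome → Fin (m G) → ℚ
  factor χ e with sel e
  ... | nothing = isNothing (lookup χ e)
    where isNothing : Maybe (Fin k) → ℚ
          isNothing nothing  = 1ℚ
          isNothing (just _) = 0ℚ
  ... | just r with ∣ Pₑ χ r e ∣ in eq
  ...   | zero  = isNothing (lookup χ e)
    where isNothing : Maybe (Fin k) → ℚ
          isNothing nothing  = 1ℚ
          isNothing (just _) = 0ℚ
  ...   | suc s = pick (lookup χ e)
    where pick : Maybe (Fin k) → ℚ
          pick nothing  = 0ℚ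
          pick (just c) = if lookup (Pₑ χ r e) c then + 1 / suc s else 0ℚ

  -- probability of the outcome χ (chain rule: uniform, independent choices
  -- from P_r(e) for every edge e ∈ S_r, in every round r)
  mass : Outcome → ℚ
  mass χ = foldr _*_ 1ℚ (map (factor χ) (allFin (m G)))

  allVecs : ∀ {A : Set} → List A → (l : ℕ) → List (Vec A l)
  allVecs xs zero    = [] ∷ []
  allVecs xs (suc l) = concatMap (λ x → map (x ∷_) (allVecs xs l)) xs

  allOutcomes : List Outcome
  allOutcomes = allVecs (nothing ∷ map just (allFin k)) (m G)

  Pr : (Outcome → Bool) → ℚ
  Pr A = foldr _+_ 0ℚ (map (λ χ → if A χ then mass χ else 0ℚ) allOutcomes)

_≟ˢ_ : ∀ {k} → Subset k → Subset k → Bool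
S ≟ˢ S′ = does (≡-dec BoolP._≟_ S S′)

image : ∀ {k} → Permutation′ k → Subset k → Subset k
image π S = tabulate λ c → lookup S (π ⟨$⟩ˡ c)

{-# OPTIONS --safe #-}
-- Renaming every tentative colour by π is a bijection of the outcome space.
-- It preserves the probability of each outcome: the palettes are renamed
-- along with the colours, so their sizes, and hence all the uniform-choice
-- factors, are unchanged. And it maps the palette P_i(u) to π(P_i(u)).
module Submission where

open import Defs
open import Data.Nat using (ℕ; zero; suc)
import Data.Nat.Properties as ℕ
open import Data.Integer using (+_)
open import Data.Rational using (ℚ; 0ℚ; 1ℚ; _/_; _*_; _+_; _<_; NonZero; ceiling)
import Data.Rational.Properties as ℚ
open import Data.Bool using (Bool; true; false; not; _∧_; _∨_; if_then_else_)
open import Data.Maybe as Maybe using (Maybe; just; nothing)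
open import Data.Product using (proj₁; proj₂)
open import Data.Fin as Fin using (Fin)
open import Data.Fin.Subset using (Subset; ∣_∣; _∩_)
open import Data.Fin.Permutation as Perm using (Permutation′; _⟨$⟩ˡ_; _⟨$⟩ʳ_; inverseˡ; inverseʳ)
open import Data.List as List using (List; []; _∷_; _++_; allFin; concatMap)
import Data.List.Properties as List
open import Data.Vec as Vec using (Vec; []; _∷_; lookup)
open import Data.Vec.Properties using (lookup-map; lookup∘tabulate; lookup-zipWith; tabulate-cong)
open import Data.Vec.Relation.Binary.Pointwise.Extensional using (ext; Pointwise-≡⇒≡)
import Algebra.Properties.CommutativeMonoid.Sum as CommutativeMonoidSum
open import Function using (_∘_; mk⇔)
import Function
open import Relation.Nullary.Decidable using (does; does-⇔)
open import Relation.Binary.PropositionalEquality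
open ≡-Reasoning

module ℕΣ = CommutativeMonoidSum ℕ.+-0-commutativeMonoid
module ℚΣ = CommutativeMonoidSum ℚ.+-0-commutativeMonoid

∣p∣≡∑ : ∀ {k} (p : Subset k) → ∣ p ∣ ≡ ℕΣ.sum (λ c → if lookup p c then 1 else 0)
∣p∣≡∑ []          = refl
∣p∣≡∑ (true ∷ p)  = cong suc (∣p∣≡∑ p)
∣p∣≡∑ (false ∷ p) = ∣p∣≡∑ p

module _ {k : ℕ} (π : Permutation′ k) where

  lookup-image : ∀ (p : Subset k) c → lookup (image π p) c ≡ lookup p (π ⟨$⟩ˡ c)
  lookup-image p = lookup∘tabulate _

  ∣image∣≡∣∣ : ∀ (p : Subset k) → ∣ image π p ∣ ≡ ∣ p ∣
  ∣image∣≡∣∣ p = begin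
    ∣ image π p ∣                                               ≡⟨ ∣p∣≡∑ (image π p) ⟩
    ℕΣ.sum (λ c → if lookup (image π p) c then 1 else 0)        ≡⟨ ℕΣ.sum-cong-≗ (cong (λ b → if b then 1 else 0) ∘ lookup-image p) ⟩
    ℕΣ.sum (λ c → if lookup p (π ⟨$⟩ˡ c) then 1 else 0)         ≡⟨ ℕΣ.sum-permute (λ c → if lookup p c then 1 else 0) (Perm.flip π) ⟨
    ℕΣ.sum (λ c → if lookup p c then 1 else 0)                  ≡⟨ ∣p∣≡∑ p ⟨
    ∣ p ∣                                                       ∎

  image-∩ : ∀ (p q : Subset k) → image π p ∩ image π q ≡ image π (p ∩ q)
  image-∩ p q = Pointwise-≡⇒≡ (ext λ c → begin
    lookup (image π p ∩ image π q) c                ≡⟨ lookup-zipWith _∧_ c (image π p) (image π q) ⟩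
    lookup (image π p) c ∧ lookup (image π q) c     ≡⟨ cong₂ _∧_ (lookup-image p c) (lookup-image q c) ⟩
    lookup p (π ⟨$⟩ˡ c) ∧ lookup q (π ⟨$⟩ˡ c)       ≡⟨ lookup-zipWith _∧_ (π ⟨$⟩ˡ c) p q ⟨
    lookup (p ∩ q) (π ⟨$⟩ˡ c)                       ≡⟨ lookup-image (p ∩ q) c ⟨
    lookup (image π (p ∩ q)) c                      ∎)

  relabel : Maybe (Fin k) → Maybe (Fin k)
  relabel = Maybe.map (π ⟨$⟩ʳ_)

  does-⟨$⟩ʳ-≟ : ∀ d c → does ((π ⟨$⟩ʳ d) Fin.≟ c) ≡ does (d Fin.≟ (π ⟨$⟩ˡ c))
  does-⟨$⟩ʳ-≟ d c = does-⇔ (mk⇔ (λ { refl → sym (inverseˡ π) }) (λ { refl → inverseʳ π })) ((π ⟨$⟩ʳ d) Fin.≟ c) (d Fin.≟ (π ⟨$⟩ˡ c))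

sumℚ : List ℚ → ℚ
sumℚ = List.foldr _+_ 0ℚ

sumℚ-++ : ∀ xs ys → sumℚ (xs ++ ys) ≡ sumℚ xs + sumℚ ys
sumℚ-++ []       ys = sym (ℚ.+-identityˡ (sumℚ ys))
sumℚ-++ (x ∷ xs) ys = trans (cong (_+_ x) (sumℚ-++ xs ys)) (sym (ℚ.+-assoc x (sumℚ xs) (sumℚ ys)))

sumℚ-concatMap : ∀ {A B : Set} (g : B → ℚ) (F : A → List B) xs →
                 sumℚ (List.map g (concatMap F xs)) ≡ sumℚ (List.map (λ x → sumℚ (List.map g (F x))) xs)
sumℚ-concatMap g F []       = refl
sumℚ-concatMap g F (x ∷ xs) = begin
  sumℚ (List.map g (F x ++ concatMap F xs))                         ≡⟨ cong sumℚ (List.map-++ g (F x) (concatMap F xs)) ⟩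
  sumℚ (List.map g (F x) ++ List.map g (concatMap F xs))            ≡⟨ sumℚ-++ (List.map g (F x)) _ ⟩
  sumℚ (List.map g (F x)) + sumℚ (List.map g (concatMap F xs))      ≡⟨ cong (_+_ (sumℚ (List.map g (F x)))) (sumℚ-concatMap g F xs) ⟩
  sumℚ (List.map g (F x)) + sumℚ (List.map (λ x → sumℚ (List.map g (F x))) xs) ∎

sumℚ-tabulate : ∀ {n} (f : Fin n → ℚ) → sumℚ (List.tabulate f) ≡ ℚΣ.sum f
sumℚ-tabulate {zero}  f = refl
sumℚ-tabulate {suc n} f = cong (_+_ (f Fin.zero)) (sumℚ-tabulate (f ∘ Fin.suc))

sumℚ-allFin : ∀ {n} (f : Fin n → ℚ) → sumℚ (List.map f (allFin n)) ≡ ℚΣ.sum f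
sumℚ-allFin f = trans (cong sumℚ (List.map-tabulate Function.id f)) (sumℚ-tabulate f)

maybeFins : ∀ k → List (Maybe (Fin k))
maybeFins k = nothing ∷ List.map just (allFin k)

sumℚ-maybeFins-relabel : ∀ {k} (π : Permutation′ k) (h : Maybe (Fin k) → ℚ) →
                         sumℚ (List.map (h ∘ relabel π) (maybeFins k)) ≡ sumℚ (List.map h (maybeFins k))
sumℚ-maybeFins-relabel {k} π h = cong (_+_ (h nothing)) (begin
  sumℚ (List.map (h ∘ relabel π) (List.map just (allFin k)))  ≡⟨ cong sumℚ (List.map-∘ (allFin k)) ⟨
  sumℚ (List.map (h ∘ just ∘ (π ⟨$⟩ʳ_)) (allFin k))           ≡⟨ sumℚ-allFin (h ∘ just ∘ (π ⟨$⟩ʳ_)) ⟩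
  ℚΣ.sum (h ∘ just ∘ (π ⟨$⟩ʳ_))                               ≡⟨ ℚΣ.sum-permute (h ∘ just) π ⟨
  ℚΣ.sum (h ∘ just)                                           ≡⟨ sumℚ-allFin (h ∘ just) ⟨
  sumℚ (List.map (h ∘ just) (allFin k))                       ≡⟨ cong sumℚ (List.map-∘ (allFin k)) ⟩
  sumℚ (List.map h (List.map just (allFin k)))                ∎)

module _ {k : ℕ} where

  isNothingℚ : Maybe (Fin k) → ℚ
  isNothingℚ nothing  = 1ℚ
  isNothingℚ (just _) = 0ℚ

  -- s is ∣ p ∣, passed separately to mirror the case split in `factor`.
  uniformProb : (s : ℕ) (p : Subset k) → Maybe (Fin k) → ℚ
  uniformProb zero    p c        = isNothingℚ c
  uniformProb (suc s) p nothing  = 0ℚ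
  uniformProb (suc s) p (just c) = if lookup p c then + 1 / suc s else 0ℚ

  uniformProb-image : ∀ (π : Permutation′ k) s p c → uniformProb s (image π p) (relabel π c) ≡ uniformProb s p c
  uniformProb-image π zero    p nothing  = refl
  uniformProb-image π zero    p (just c) = refl
  uniformProb-image π (suc s) p nothing  = refl
  uniformProb-image π (suc s) p (just c)
    rewrite lookup-image π p (π ⟨$⟩ʳ c) | inverseˡ π {c} = refl

module _ {k : ℕ} (G : Graph) (T : ℕ) (sel : Fin (m G) → Maybe (Fin T)) where
  open Nibble G k T sel

  factor′ : Outcome → Fin (m G) → Maybe (Fin T) → ℚ
  factor′ χ e nothing  = isNothingℚ (lookup χ e)
  factor′ χ e (just r) = uniformProb ∣ Pₑ χ r e ∣ (Pₑ χ r e) (lookup χ e)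

  -- `factor` splits on ∣ Pₑ χ r e ∣ with `in eq`, so its unfolding mentions
  -- that number both as a value and inside the type of `refl`, and cannot be
  -- with-abstracted directly. An opaque copy of the number breaks the link.
  opaque
    paletteSize : Outcome → Fin T → Fin (m G) → ℕ
    paletteSize χ r e = ∣ Pₑ χ r e ∣

    paletteSize≡∣Pₑ∣ : ∀ χ r e → paletteSize χ r e ≡ ∣ Pₑ χ r e ∣
    paletteSize≡∣Pₑ∣ χ r e = refl

    ∣Pₑ∣≡-from-paletteSize : ∀ χ r e {s} → paletteSize χ r e ≡ s → ∣ Pₑ χ r e ∣ ≡ s
    ∣Pₑ∣≡-from-paletteSize χ r e eq = eq

  factor≡factor′ : ∀ χ e → factor χ e ≡ factor′ χ e (sel e)
  factor≡factor′ χ e with sel e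
  ... | nothing with lookup χ e
  ...   | nothing = refl
  ...   | just _  = refl
  factor≡factor′ χ e | just r
    rewrite ℕ.≡-irrelevant refl (∣Pₑ∣≡-from-paletteSize χ r e (paletteSize≡∣Pₑ∣ χ r e))
    with ∣ Pₑ χ r e ∣ | paletteSize≡∣Pₑ∣ χ r e
  ... | zero | _ with lookup χ e
  ...   | nothing = refl
  ...   | just _  = refl
  factor≡factor′ χ e | just r | suc _ | _ with lookup χ e
  ...   | nothing = refl
  ...   | just _  = refl

  Pr-cong : ∀ {A B : Outcome → Bool} → (∀ χ → A χ ≡ B χ) → Pr A ≡ Pr B
  Pr-cong A≗B = cong sumℚ (List.map-cong (λ χ → cong (λ b → if b then mass χ else 0ℚ) (A≗B χ)) allOutcomes)

  sumℚ-allVecs-map : ∀ {A : Set} (xs : List A) (t : A → A) →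
                     (∀ h → sumℚ (List.map (h ∘ t) xs) ≡ sumℚ (List.map h xs)) →
                     ∀ l (g : Vec A l → ℚ) →
                     sumℚ (List.map (g ∘ Vec.map t) (allVecs xs l)) ≡ sumℚ (List.map g (allVecs xs l))
  sumℚ-allVecs-map xs t t-invariant zero    g = refl
  sumℚ-allVecs-map xs t t-invariant (suc l) g = begin
    sumℚ (List.map (g ∘ Vec.map t) (concatMap (λ x → List.map (x ∷_) vs) xs))
      ≡⟨ sumℚ-concatMap _ _ xs ⟩
    sumℚ (List.map (λ x → sumℚ (List.map (g ∘ Vec.map t) (List.map (x ∷_) vs))) xs)
      ≡⟨ cong sumℚ (List.map-cong (λ x → cong sumℚ (List.map-∘ vs)) xs) ⟨
    sumℚ (List.map (λ x → sumℚ (List.map (λ v → g (t x ∷ Vec.map t v)) vs)) xs)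
      ≡⟨ cong sumℚ (List.map-cong (λ x → sumℚ-allVecs-map xs t t-invariant l (g ∘ (t x ∷_))) xs) ⟩
    sumℚ (List.map (λ x → sumℚ (List.map (g ∘ (t x ∷_)) vs)) xs)
      ≡⟨ t-invariant (λ y → sumℚ (List.map (g ∘ (y ∷_)) vs)) ⟩
    sumℚ (List.map (λ x → sumℚ (List.map (g ∘ (x ∷_)) vs)) xs)
      ≡⟨ cong sumℚ (List.map-cong (λ x → cong sumℚ (List.map-∘ vs)) xs) ⟩
    sumℚ (List.map (λ x → sumℚ (List.map g (List.map (x ∷_) vs))) xs)
      ≡⟨ sumℚ-concatMap _ _ xs ⟨
    sumℚ (List.map g (concatMap (λ x → List.map (x ∷_) vs) xs))
      ∎
    where vs = allVecs xs l

  module _ (π : Permutation′ k) where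

    relabelOutcome : Outcome → Outcome
    relabelOutcome = Vec.map (relabel π)

    colourIsᵇ-relabel : ∀ χ f c → colourIsᵇ (relabelOutcome χ) f c ≡ colourIsᵇ χ f (π ⟨$⟩ˡ c)
    colourIsᵇ-relabel χ f c rewrite lookup-map f (relabel π) χ with lookup χ f
    ... | nothing = refl
    ... | just d  = does-⟨$⟩ʳ-≟ π d c

    P-relabel : ∀ χ i u → P (relabelOutcome χ) i u ≡ image π (P χ i u)
    P-relabel χ i u = tabulate-cong λ c → trans
      (cong (λ bs → not (List.foldr _∨_ false bs))
        (List.map-cong (λ f → cong (λ b → incidentᵇ G f u ∧ selectedBeforeᵇ f i ∧ b) (colourIsᵇ-relabel χ f c)) (allFin _)))
      (sym (lookup∘tabulate _ (π ⟨$⟩ˡ c)))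

    Pₑ-relabel : ∀ χ i e → Pₑ (relabelOutcome χ) i e ≡ image π (Pₑ χ i e)
    Pₑ-relabel χ i e rewrite P-relabel χ i (proj₁ (ends G e)) | P-relabel χ i (proj₂ (ends G e)) =
      image-∩ π (P χ i (proj₁ (ends G e))) (P χ i (proj₂ (ends G e)))

    factor′-relabel : ∀ χ e r? → factor′ (relabelOutcome χ) e r? ≡ factor′ χ e r?
    factor′-relabel χ e nothing rewrite lookup-map e (relabel π) χ with lookup χ e
    ... | nothing = refl
    ... | just _  = refl
    factor′-relabel χ e (just r)
      rewrite lookup-map e (relabel π) χ | Pₑ-relabel χ r e | ∣image∣≡∣∣ π (Pₑ χ r e) =
      uniformProb-image π ∣ Pₑ χ r e ∣ (Pₑ χ r e) (lookup χ e)

    mass-relabel : ∀ χ → mass (relabelOutcome χ) ≡ mass χ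
    mass-relabel χ = cong (List.foldr _*_ 1ℚ) (List.map-cong factor-relabel (allFin _))
      where
      factor-relabel : ∀ e → factor (relabelOutcome χ) e ≡ factor χ e
      factor-relabel e = begin
        factor (relabelOutcome χ) e           ≡⟨ factor≡factor′ (relabelOutcome χ) e ⟩
        factor′ (relabelOutcome χ) e (sel e)  ≡⟨ factor′-relabel χ e (sel e) ⟩
        factor′ χ e (sel e)                   ≡⟨ factor≡factor′ χ e ⟨
        factor χ e                            ∎

    Pr-relabel : ∀ (A : Outcome → Bool) → Pr (A ∘ relabelOutcome) ≡ Pr A
    Pr-relabel A = begin
      sumℚ (List.map (λ χ → if A (relabelOutcome χ) then mass χ else 0ℚ) allOutcomes)
        ≡⟨ cong sumℚ (List.map-cong (λ χ → cong (λ q → if A (relabelOutcome χ) then q else 0ℚ) (mass-relabel χ)) allOutcomes) ⟨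
      sumℚ (List.map (λ χ → if A (relabelOutcome χ) then mass (relabelOutcome χ) else 0ℚ) allOutcomes)
        ≡⟨ sumℚ-allVecs-map (maybeFins k) (relabel π) (sumℚ-maybeFins-relabel π) (m G) (λ χ → if A χ then mass χ else 0ℚ) ⟩
      sumℚ (List.map (λ χ → if A χ then mass χ else 0ℚ) allOutcomes)
        ∎

lemma2p2 : (ε : ℚ) → 0ℚ < ε → ε < + 1 / 10 → {{_ : NonZero ε}} →
           (Δ : ℕ) (G : Graph) → Simple G → MaxDegreeAtMost G Δ →
           (k : ℕ) → + k ≡ ceiling ((1ℚ + ε) * (+ Δ / 1)) →
           (T : ℕ) → IsNibbleT ε T →
           (sel : Fin (m G) → Maybe (Fin T)) →
           (u : Fin (n G)) (i : Fin T) (C : Subset k) (π : Permutation′ k) →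
           Nibble.Pr G k T sel (λ χ → Nibble.P G k T sel χ i u ≟ˢ C)
             ≡ Nibble.Pr G k T sel (λ χ → image π (Nibble.P G k T sel χ i u) ≟ˢ C)
lemma2p2 _ _ _ _ G _ _ k _ T _ sel u i C π = begin
  Pr (λ χ → P χ i u ≟ˢ C)                           ≡⟨ Pr-relabel G T sel π (λ χ → P χ i u ≟ˢ C) ⟨
  Pr (λ χ → P (relabelOutcome G T sel π χ) i u ≟ˢ C) ≡⟨ Pr-cong G T sel (λ χ → cong (_≟ˢ C) (P-relabel G T sel π χ i u)) ⟩
  Pr (λ χ → image π (P χ i u) ≟ˢ C)                 ∎
  where open Nibble G k T sel
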